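{- In the classical scheduling model with work weights, barrier synchronization can increase the optimum cost: there exist a number of processors $P$ (e.g. $P=3$) and a DAG with positive integer work weights such that the minimum makespan of a valid schedule with barrier synchronization is strictly larger than the minimum makespan of a valid schedule without barrier synchronization.
   Context: A DAG $G=(V,E)$ with work weights $w:V\to\mathbb{Z}^+$ is scheduled on $P$ processors ($[P]=\{1,\dots,P\}$). Classical scheduling with work weights: a schedule is $\pi:V\to[P]$ and start times $t:V\to\mathbb{Z}_{\ge0}$ such that for distinct $u,v$ with $\pi(u)=\pi(v)$ the intervals $(t(u),t(u)+w(u)]$ and $(t(v),t(v)+w(v)]$ are disjoint, and $t(u)+w(u)\le t(v)$ for all $(u,v)\in E$ (communication between processors is free). Its makespan is $\max_v (t(v)+w(v))$. With barrier synchronization, a schedule must additionally satisfy: for each $(u,v)\in E$ with $\pi(u)\neq\pi(v)$ there is a time $t_0\in[t(u)+w(u),\,t(v)]$ such that no node $v_0\in V$ has $t_0\in(t(v_0),t(v_0)+w(v_0)]$ (i.e. no processor is computing at time $t_0$). -}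

module Defs where

open import Data.Nat using (ℕ; _+_; _≤_; _<_; suc; _⊔_)
open import Data.List using (foldr; map; allFin)
open import Data.Fin using (Fin)
open import Data.Product using (_×_; _,_; ∃-syntax)
open import Data.Sum using (_⊎_)
open import Data.List using (List)
open import Data.List.Membership.Propositional using (_∈_)
open import Relation.Nullary using (¬_)
open import Relation.Binary.PropositionalEquality using (_≡_; _≢_)
open import Relation.Binary.Construct.Closure.Transitive using (TransClosure)

record WDAG : Set where
  field
    n      : ℕ
    edges  : List (Fin n × Fin n)
    w      : Fin n → ℕ
    w-pos  : ∀ v → 1 ≤ w v
    acyclic : ∀ v → ¬ TransClosure (λ a b → (a , b) ∈ edges) v v

open WDAG public

record Schedule (G : WDAG) (P : ℕ) : Set where
  field
    proc  : Fin (n G) → Fin P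
    start : Fin (n G) → ℕ

open Schedule public

Busy : {G : WDAG} {P : ℕ} → Schedule G P → Fin (n G) → ℕ → Set
Busy {G} s v t = (start s v < t) × (t ≤ start s v + w G v)

-- validity in the classical model (free communication)
Valid : {G : WDAG} {P : ℕ} → Schedule G P → Set
Valid {G} s =
  (∀ u v → u ≢ v → proc s u ≡ proc s v →
     (start s u + w G u ≤ start s v) ⊎ (start s v + w G v ≤ start s u))
  × (∀ u v → (u , v) ∈ edges G → start s u + w G u ≤ start s v)

BarrierValid : {G : WDAG} {P : ℕ} → Schedule G P → Set
BarrierValid {G} s = Valid s ×
  (∀ u v → (u , v) ∈ edges G → proc s u ≢ proc s v →
     ∃[ t₀ ] ((start s u + w G u ≤ t₀) × (t₀ ≤ start s v)
              × (∀ v₀ → ¬ Busy s v₀ t₀)))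

makespan : {G : WDAG} {P : ℕ} → Schedule G P → ℕ
makespan {G} s = foldr _⊔_ 0 (map (λ v → start s v + w G v) (allFin (n G)))

module Submission where

open import Defs
open import Data.Nat using (ℕ; _<_; _≤_; _+_; _⊔_; z≤n; s≤s; _≤?_)
open import Data.Nat.Properties
open import Data.Product using (_×_; ∃-syntax; _,_; proj₁; proj₂)
open import Data.Sum using (_⊎_; inj₁; inj₂)
open import Data.Fin using (Fin; zero; suc)
import Data.Fin.Properties as Fin
open import Data.List using (List; []; _∷_; foldr)
open import Data.List.Relation.Unary.Any using (here; there)
open import Data.List.Membership.Propositional using (_∈_)
open import Data.List.Membership.Propositional.Properties using (∈-map⁺; ∈-allFin)
open import Data.Empty using (⊥-elim)
open import Relation.Binary.Core using (Rel)
open import Relation.Nullary using (¬_; yes; no; contradiction)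
open import Relation.Binary.PropositionalEquality using (_≡_; _≢_; refl; sym; trans)
open import Relation.Binary.Construct.Closure.Transitive using (TransClosure; [_]; _∷_)

-- Take a fork source → child₁, source → child₂ of unit-weight nodes plus an
-- isolated filler node of weight 2, on 3 processors. Without barriers the filler
-- runs on its own processor during (0, 2] while source, child₁ share one processor
-- and child₂ takes another, so the makespan is 2. With barriers and makespan 2 the
-- filler is busy throughout (0, 2], so there is no idle moment between the source
-- and either child; hence all three fork nodes share a processor and need time 3.

finish : {G : WDAG} {P : ℕ} → Schedule G P → Fin (n G) → ℕ
finish {G} s v = start s v + w G v

∈⇒≤-foldr-⊔ : ∀ {m xs} → m ∈ xs → m ≤ foldr _⊔_ 0 xs
∈⇒≤-foldr-⊔ {xs = x ∷ _} (here refl) = m≤m⊔n x _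
∈⇒≤-foldr-⊔ {xs = x ∷ _} (there m∈xs) = m≤n⇒m≤o⊔n x (∈⇒≤-foldr-⊔ m∈xs)

finish≤makespan : {G : WDAG} {P : ℕ} (s : Schedule G P) (v : Fin (n G)) →
                  finish s v ≤ makespan s
finish≤makespan s v = ∈⇒≤-foldr-⊔ (∈-map⁺ (finish s) (∈-allFin v))

module _ {G : WDAG} {P : ℕ} (s : Schedule G P) where

  edge-local-if-spanned : BarrierValid s → ∀ {u v} → (u , v) ∈ edges G →
                          ∀ x → start s x < finish s u → start s v ≤ finish s x →
                          proc s u ≡ proc s v
  edge-local-if-spanned (_ , barrier) {u} {v} uv x x<u v≤x with proc s u Fin.≟ proc s v
  ... | yes same = same
  ... | no differ with barrier u v uv differ
  ... | t₀ , u≤t₀ , t₀≤v , idle = ⊥-elim (idle x (<-≤-trans x<u u≤t₀ , ≤-trans t₀≤v v≤x))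

  chain≤makespan : ∀ {u x y} → finish s u ≤ start s x → finish s x ≤ start s y →
                   finish s u + (w G x + w G y) ≤ makespan s
  chain≤makespan {u} {x} {y} u≤x x≤y = begin
    finish s u + (w G x + w G y) ≡⟨ sym (+-assoc (finish s u) (w G x) (w G y)) ⟩
    finish s u + w G x + w G y   ≤⟨ +-monoˡ-≤ (w G y) (+-monoˡ-≤ (w G x) u≤x) ⟩
    finish s x + w G y           ≤⟨ +-monoˡ-≤ (w G y) x≤y ⟩
    finish s y                   ≤⟨ finish≤makespan s y ⟩
    makespan s                   ∎
    where open ≤-Reasoning

  fork-on-one-processor≤makespan :
    Valid s → ∀ {u v₁ v₂} → (u , v₁) ∈ edges G → (u , v₂) ∈ edges G →
    v₁ ≢ v₂ → proc s v₁ ≡ proc s v₂ →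
    finish s u + (w G v₁ + w G v₂) ≤ makespan s
  fork-on-one-processor≤makespan (disjoint , precedence) {u} {v₁} {v₂} uv₁ uv₂ v₁≢v₂ same
    with disjoint v₁ v₂ v₁≢v₂ same
  ... | inj₁ v₁≤v₂ = chain≤makespan (precedence u v₁ uv₁) v₁≤v₂
  ... | inj₂ v₂≤v₁ rewrite +-comm (w G v₁) (w G v₂) =
    chain≤makespan (precedence u v₂ uv₂) v₂≤v₁

acyclic-if-sources-not-targets : ∀ {a ℓ} {A : Set a} {R : Rel A ℓ} →
                                 (∀ {x y z} → R x y → ¬ R z x) →
                                 ∀ v → ¬ TransClosure R v v
acyclic-if-sources-not-targets source-not-target v [ r ] = source-not-target r r
acyclic-if-sources-not-targets {R = R} source-not-target v (r ∷ p) =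
  source-not-target r (proj₂ (last-step p))
  where
  last-step : ∀ {x y} → TransClosure R x y → ∃[ z ] R z y
  last-step [ r ] = _ , r
  last-step (_ ∷ p) = last-step p

pattern source = zero
pattern child₁ = suc zero
pattern child₂ = suc (suc zero)
pattern filler = suc (suc (suc zero))

fork-edges : List (Fin 4 × Fin 4)
fork-edges = (source , child₁) ∷ (source , child₂) ∷ []

fork-weight : Fin 4 → ℕ
fork-weight filler = 2
fork-weight _      = 1

fork-weight-pos : ∀ v → 1 ≤ fork-weight v
fork-weight-pos source = s≤s z≤n
fork-weight-pos child₁ = s≤s z≤n
fork-weight-pos child₂ = s≤s z≤n
fork-weight-pos filler = s≤s z≤n

fork-edge-source : ∀ {x y} → (x , y) ∈ fork-edges → x ≡ source
fork-edge-source (here refl) = refl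
fork-edge-source (there (here refl)) = refl

fork-edge-target : ∀ {x y} → (x , y) ∈ fork-edges → y ≢ source
fork-edge-target (here refl) ()
fork-edge-target (there (here refl)) ()

fork-acyclic : ∀ v → ¬ TransClosure (λ a b → (a , b) ∈ fork-edges) v v
fork-acyclic = acyclic-if-sources-not-targets λ xy zx →
  fork-edge-target zx (fork-edge-source xy)

fork : WDAG
fork = record
  { n = 4 ; edges = fork-edges ; w = fork-weight
  ; w-pos = fork-weight-pos ; acyclic = fork-acyclic }

fork-schedule : Schedule fork 3
fork-schedule = record { proc = processor ; start = start-time }
  where
  processor : Fin 4 → Fin 3
  processor child₂ = suc zero
  processor filler = suc (suc zero)
  processor _      = zero

  start-time : Fin 4 → ℕ
  start-time child₁ = 1
  start-time child₂ = 1
  start-time _      = 0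

fork-schedule-valid : Valid fork-schedule
fork-schedule-valid = disjoint , precedence
  where
  disjoint : ∀ u v → u ≢ v → proc fork-schedule u ≡ proc fork-schedule v →
             (finish fork-schedule u ≤ start fork-schedule v) ⊎
             (finish fork-schedule v ≤ start fork-schedule u)
  disjoint source child₁ _ _ = inj₁ ≤-refl
  disjoint child₁ source _ _ = inj₂ ≤-refl
  disjoint source source u≢v _ = contradiction refl u≢v
  disjoint child₁ child₁ u≢v _ = contradiction refl u≢v
  disjoint child₂ child₂ u≢v _ = contradiction refl u≢v
  disjoint filler filler u≢v _ = contradiction refl u≢v
  disjoint source child₂ _ ()
  disjoint source filler _ ()
  disjoint child₁ child₂ _ ()
  disjoint child₁ filler _ ()
  disjoint child₂ source _ ()
  disjoint child₂ child₁ _ ()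
  disjoint child₂ filler _ ()
  disjoint filler source _ ()
  disjoint filler child₁ _ ()
  disjoint filler child₂ _ ()

  precedence : ∀ u v → (u , v) ∈ fork-edges →
               finish fork-schedule u ≤ start fork-schedule v
  precedence _ _ (here refl) = ≤-refl
  precedence _ _ (there (here refl)) = ≤-refl

module _ {P : ℕ} (s : Schedule fork P) (barrier-valid : BarrierValid s)
         (makespan≤2 : makespan s ≤ 2) where

  filler-starts-at-0 : start s filler ≤ 0
  filler-starts-at-0 =
    +-cancelʳ-≤ 2 (start s filler) 0 (≤-trans (finish≤makespan s filler) makespan≤2)

  source-local : ∀ {x} → (source , x) ∈ fork-edges → proc s source ≡ proc s x
  source-local {x} e = edge-local-if-spanned s barrier-valid e filler
    (≤-<-trans filler-starts-at-0 (m≤n+m 1 (start s source)))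
    (≤-trans (m+n≤o⇒m≤o (start s x) (≤-trans (finish≤makespan s x) makespan≤2))
             (m≤n+m 2 (start s filler)))

  children-on-one-processor : proc s child₁ ≡ proc s child₂
  children-on-one-processor =
    trans (sym (source-local (here refl))) (source-local (there (here refl)))

  makespan≥3 : 3 ≤ makespan s
  makespan≥3 = ≤-trans (+-monoˡ-≤ 2 (m≤n+m 1 (start s source)))
    (fork-on-one-processor≤makespan s (proj₁ barrier-valid) (here refl) (there (here refl))
                                     (λ ()) children-on-one-processor)

barrier-makespan>2 : ∀ {P} (s : Schedule fork P) → BarrierValid s → 2 < makespan s
barrier-makespan>2 s barrier-valid with makespan s ≤? 2
... | yes makespan≤2 = ⊥-elim (<⇒≱ (makespan≥3 s barrier-valid makespan≤2) makespan≤2)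
... | no makespan≰2 = ≰⇒> makespan≰2

proposition4p5 : ∃[ P ] ∃[ G ] ∃[ s ] ((1 ≤ P) × Valid {G} {P} s
    × (∀ (s' : Schedule G P) → BarrierValid s' → makespan s < makespan s'))
proposition4p5 = 3 , fork , fork-schedule , s≤s z≤n , fork-schedule-valid ,
  barrier-makespan>2
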